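{- Let $T$ be a finite tree on $n$ vertices having exactly $d$ vertices of degree $2$. Then $b(T)\le \lceil\sqrt{n+d}\rceil$.
   Context: Burning process on a finite simple connected graph $G$: given a sequence of vertices $S=(x_1,\ldots,x_k)$, all vertices are unburned in round $0$. In round $i$ ($i=1,\ldots,k$), $x_i$ is burned (if not already burned), and every unburned vertex having a neighbour burned by the end of round $i-1$ becomes burned; burned vertices stay burned. $S$ is a burning sequence if all vertices are burned at the end of round $k$; the burning number $b(G)$ is the length of a shortest burning sequence. -}

module Defs where

open import Data.Nat using (ℕ; zero; suc; _+_; _*_; _≤_; _≤?_)
open import Data.Nat.Properties using (_≟_)
open import Data.Bool using (Bool; true; false; if_then_else_)
open import Data.Fin using (Fin)
open import Data.List using (List; []; _∷_; length; filter; filterᵇ; map; sum; allFin)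
open import Data.List.Relation.Unary.Unique.Propositional using (Unique)
open import Data.Maybe using (Maybe; just; nothing)
open import Data.Product using (Σ; ∃; _×_; _,_)
open import Data.Sum using (_⊎_)
open import Data.Empty using (⊥)
open import Relation.Nullary using (¬_; does)
open import Relation.Binary.PropositionalEquality using (_≡_)

record Graph (n : ℕ) : Set where
  field
    adj    : Fin n → Fin n → Bool
    sym    : ∀ u v → adj u v ≡ adj v u
    irrefl : ∀ v → adj v v ≡ false
open Graph public

Adj : ∀ {n} → Graph n → Fin n → Fin n → Set
Adj G u v = adj G u v ≡ true

data Walk {n} (G : Graph n) : Fin n → Fin n → Set where
  [] : ∀ {v} → Walk G v v
  _∷_ : ∀ {u w v} → Adj G u w → Walk G w v → Walk G u v

Connected : ∀ {n} → Graph n → Set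
Connected G = ∀ u v → Walk G u v

ClosesPath : ∀ {n} → Graph n → Fin n → List (Fin n) → Set
ClosesPath G first [] = ⊥
ClosesPath G first (x ∷ []) = Adj G x first
ClosesPath G first (x ∷ y ∷ xs) = Adj G x y × ClosesPath G first (y ∷ xs)

IsCycle : ∀ {n} → Graph n → List (Fin n) → Set
IsCycle G [] = ⊥
IsCycle G (v ∷ vs) = 3 ≤ length (v ∷ vs) × Unique (v ∷ vs) × ClosesPath G v (v ∷ vs)

Acyclic : ∀ {n} → Graph n → Set
Acyclic G = ∀ cs → ¬ IsCycle G cs

IsTree : ∀ {n} → Graph n → Set
IsTree G = Connected G × Acyclic G

degree : ∀ {n} → Graph n → Fin n → ℕ
degree {n} G u = length (filterᵇ (adj G u) (allFin n))

numDeg2 : ∀ {n} → Graph n → ℕ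
numDeg2 {n} G = length (filter (λ u → degree G u ≟ 2) (allFin n))

nth : ∀ {A : Set} → List A → ℕ → Maybe A
nth [] i = nothing
nth (x ∷ xs) zero = just x
nth (x ∷ xs) (suc i) = nth xs i

-- Burned G S i v : vertex v is burned at the end of round i when the
-- sequence S = (x₁,…,x_k) is used (round i burns x_i = nth S (i-1)).
Burned : ∀ {n} → Graph n → List (Fin n) → ℕ → Fin n → Set
Burned G S zero v = ⊥
Burned G S (suc i) v =
  Burned G S i v ⊎ (nth S i ≡ just v) ⊎ (∃ λ u → Adj G u v × Burned G S i u)

IsBurningSequence : ∀ {n} → Graph n → List (Fin n) → Set
IsBurningSequence G S = ∀ v → Burned G S (length S) v

ceilSqrtFrom : ℕ → ℕ → ℕ → ℕ
ceilSqrtFrom zero m x = m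
ceilSqrtFrom (suc fuel) m x = if does (x ≤? m * m) then m else ceilSqrtFrom fuel (suc m) x

ceilSqrt : ℕ → ℕ
ceilSqrt x = ceilSqrtFrom x 0 x

-- Root T and weigh each vertex 2 if it has degree 2 and 1 otherwise, so the
-- total weight is n + d. A hanging subtree of height h weighs at least 2h + 1.
-- Hence if T weighs at most (r + 1)² and is not within distance r of its root,
-- then near a deepest leaf one can cut off either a part that one ball of
-- radius r covers and that weighs at least 2r + 1, or a part that balls of
-- radii r and r − 1 cover and that weighs at least 4r; what remains weighs at
-- most r² or (r − 1)² respectively. By induction, balls of radii k − 1, …, 0
-- cover T when k = ⌈√(n + d)⌉, and burning their centres in this order burns T.

module Submission where

open import Defs hiding (sym)
open import Data.Nat using (ℕ; zero; suc; _+_; _*_; _∸_; _≤_; _<_; z≤n; s≤s; _⊔_; pred; _≤?_; _≤ᵇ_)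
open import Data.Nat.Properties
open import Data.Nat.Tactic.RingSolver using (solve-∀)
open import Algebra.Properties.CommutativeSemigroup +-commutativeSemigroup using (x∙yz≈y∙xz)
open import Data.Bool using (Bool; true; false; _∧_; not; T)
open import Data.Bool.Properties using (∧-identityʳ; T-≡; T-∧)
open import Function.Bundles using (Equivalence)
open import Data.List using (List; []; _∷_; length; _++_; [_]; filter; filterᵇ; allFin; replicate; map; _ʳ++_; last; reverse)
open import Data.Nat.ListAction using (sum)
open import Data.Nat.ListAction.Properties using (sum-++)
open import Data.List.Properties
  using (map-++; ++-assoc; reverse-++; ++-conicalʳ; ++-identityˡ-unique; ++-cancelʳ; ∷-injectiveˡ;
         length-map; length-++; length-replicate; length-tabulate)
open import Data.List.Relation.Unary.All as All using (All; []; _∷_)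
open import Data.List.Relation.Unary.All.Properties as All using (¬Any⇒All¬; all-filter)
open import Data.List.Relation.Unary.Any using (here; there)
open import Data.List.Membership.Propositional using (_∈_; _∉_)
open import Data.List.Membership.Propositional.Properties
  using (∈-∃++; ∈-allFin; ∈-++⁺ˡ; ∈-++⁺ʳ; ∈-++⁻; ∈-map⁺; ∈-map⁻; ∈-filter⁺; ∈-filter⁻)
open import Data.List.Relation.Unary.Unique.Propositional using (Unique)
open import Data.List.Relation.Unary.Unique.Propositional.Properties as Unique using ()
open import Data.List.Relation.Unary.AllPairs using ([]; _∷_)
open import Data.List.Relation.Unary.Linked as Linked using (Linked; _∷_)
open import Data.Fin as Fin using (Fin)
open import Data.Fin.Properties using () renaming (_≟_ to _≟ᶠ_)
import Data.List.Membership.DecPropositional as DecMembership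
open import Data.Product using (Σ; ∃; _×_; _,_; proj₁; proj₂)
open import Data.Sum using (_⊎_; inj₁; inj₂; [_,_]′; map₂)
open import Function using (_∘_; id)
open import Data.Empty using (⊥; ⊥-elim)
open import Data.Unit using (⊤; tt)
open import Data.Maybe using (just)
open import Relation.Nullary using (¬_; yes; no; does)
open import Relation.Nullary.Decidable using (dec-true; dec-false; T?)
open import Relation.Binary.PropositionalEquality
  using (_≡_; _≢_; refl; sym; trans; cong; cong₂; subst; subst₂; module ≡-Reasoning)

x≤ceilSqrtFrom² : ∀ fuel m x → x ≤ (m + fuel) * (m + fuel) →
                  x ≤ ceilSqrtFrom fuel m x * ceilSqrtFrom fuel m x
x≤ceilSqrtFrom² zero m x le = subst (λ k → x ≤ k * k) (+-identityʳ m) le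
x≤ceilSqrtFrom² (suc fuel) m x le with x ≤ᵇ m * m in x≤ᵇm²
... | true = ≤ᵇ⇒≤ x (m * m) (subst T (sym x≤ᵇm²) tt)
... | false = x≤ceilSqrtFrom² fuel (suc m) x (subst (λ k → x ≤ k * k) (+-suc m fuel) le)

x≤ceilSqrt² : ∀ x → x ≤ ceilSqrt x * ceilSqrt x
x≤ceilSqrt² x = x≤ceilSqrtFrom² x 0 x (m≤m*m x)
  where
  m≤m*m : ∀ m → m ≤ m * m
  m≤m*m zero = z≤n
  m≤m*m m@(suc _) = m≤m*n m m

double-⊔-lub : ∀ a b {c} → a + a ≤ c → b + b ≤ c → (a ⊔ b) + (a ⊔ b) ≤ c
double-⊔-lub a b a+a≤c b+b≤c with ⊔-sel a b
... | inj₁ a⊔b≡a rewrite a⊔b≡a = a+a≤c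
... | inj₂ a⊔b≡b rewrite a⊔b≡b = b+b≤c

4r+3≤[1+r]²⇒3≤r : ∀ r → suc (suc (r + r) + suc (r + r)) ≤ suc r * suc r → 3 ≤ r
4r+3≤[1+r]²⇒3≤r 0 (s≤s ())
4r+3≤[1+r]²⇒3≤r 1 (s≤s (s≤s (s≤s (s≤s ()))))
4r+3≤[1+r]²⇒3≤r 2 (s≤s (s≤s (s≤s (s≤s (s≤s (s≤s (s≤s (s≤s (s≤s ())))))))))
4r+3≤[1+r]²⇒3≤r (suc (suc (suc _))) _ = s≤s (s≤s (s≤s z≤n))

square-suc : ∀ r → suc (suc r) * suc (suc r) ≡ suc r * suc r + suc (suc r + suc r)
square-suc = solve-∀

square-suc² : ∀ r → suc (suc r) * suc (suc r) ≡ r * r + ((suc r + suc r) + (suc r + suc r))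
square-suc² = solve-∀

vertexWeight : ℕ → ℕ
vertexWeight 2 = 2
vertexWeight _ = 1

vertexWeight-pos : ∀ m → 1 ≤ vertexWeight m
vertexWeight-pos 2 = s≤s z≤n
vertexWeight-pos 0 = s≤s z≤n
vertexWeight-pos 1 = s≤s z≤n
vertexWeight-pos (suc (suc (suc _))) = s≤s z≤n

vertexWeight-mono : ∀ m → suc m ≢ 3 → vertexWeight m ≤ vertexWeight (suc m)
vertexWeight-mono 0 _ = s≤s z≤n
vertexWeight-mono 1 _ = s≤s z≤n
vertexWeight-mono 2 ≢3 = ⊥-elim (≢3 refl)
vertexWeight-mono (suc (suc (suc _))) _ = s≤s z≤n

sum-vertexWeight : ∀ {A : Set} (d : A → ℕ) xs →
                   sum (map (vertexWeight ∘ d) xs) ≡ length xs + length (filter (λ u → d u ≟ 2) xs)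
sum-vertexWeight d [] = refl
sum-vertexWeight d (x ∷ xs) with d x
... | 0 = cong suc (sum-vertexWeight d xs)
... | 1 = cong suc (sum-vertexWeight d xs)
... | 2 = cong suc (trans (cong suc (sum-vertexWeight d xs)) (sym (+-suc (length xs) _)))
... | suc (suc (suc _)) = cong suc (sum-vertexWeight d xs)

sum-map-++ : ∀ {A : Set} (f : A → ℕ) xs ys → sum (map f (xs ++ ys)) ≡ sum (map f xs) + sum (map f ys)
sum-map-++ f xs ys = trans (cong sum (map-++ f xs ys)) (sum-++ (map f xs) (map f ys))

sum-map-mono-⊆ : ∀ {A : Set} (f : A → ℕ) xs ys → Unique xs → (∀ {v} → v ∈ xs → v ∈ ys) →
                 sum (map f xs) ≤ sum (map f ys)
sum-map-mono-⊆ f [] ys _ _ = z≤n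
sum-map-mono-⊆ f (x ∷ xs) ys (x∉xs ∷ u) xs⊆ys with ∈-∃++ (xs⊆ys (here refl))
... | ys₁ , ys₂ , refl = begin
  f x + sum (map f xs)                      ≤⟨ +-monoʳ-≤ (f x) (sum-map-mono-⊆ f xs (ys₁ ++ ys₂) u xs⊆ys₁ys₂) ⟩
  f x + sum (map f (ys₁ ++ ys₂))            ≡⟨ cong (f x +_) (sum-map-++ f ys₁ ys₂) ⟩
  f x + (sum (map f ys₁) + sum (map f ys₂)) ≡⟨ x∙yz≈y∙xz (f x) (sum (map f ys₁)) (sum (map f ys₂)) ⟩
  sum (map f ys₁) + (f x + sum (map f ys₂)) ≡⟨ sum-map-++ f ys₁ (x ∷ ys₂) ⟨
  sum (map f (ys₁ ++ x ∷ ys₂))              ∎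
  where
  open ≤-Reasoning
  xs⊆ys₁ys₂ : ∀ {v} → v ∈ xs → v ∈ ys₁ ++ ys₂
  xs⊆ys₁ys₂ {v} v∈xs with ∈-++⁻ ys₁ (xs⊆ys (there v∈xs))
  ... | inj₁ v∈ys₁ = ∈-++⁺ˡ v∈ys₁
  ... | inj₂ (here refl) = ⊥-elim (All.lookup x∉xs v∈xs refl)
  ... | inj₂ (there v∈ys₂) = ∈-++⁺ʳ ys₁ v∈ys₂

Unique⇒length≤ : ∀ {n} {xs : List (Fin n)} → Unique xs → length xs ≤ n
Unique⇒length≤ {n} {xs} u = subst₂ _≤_ (sum-ones xs) (trans (sum-ones (allFin n)) (length-tabulate id))
  (sum-map-mono-⊆ (λ _ → 1) xs (allFin n) u (λ {v} _ → ∈-allFin v))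
  where
  sum-ones : ∀ (ys : List (Fin n)) → sum (map (λ _ → 1) ys) ≡ length ys
  sum-ones [] = refl
  sum-ones (_ ∷ ys) = cong suc (sum-ones ys)

filterᵇ-cong : ∀ {A : Set} {f g : A → Bool} xs → (∀ {x} → x ∈ xs → f x ≡ g x) →
               filterᵇ f xs ≡ filterᵇ g xs
filterᵇ-cong [] _ = refl
filterᵇ-cong {f = f} {g} (x ∷ xs) f≗g with f x | g x | f≗g (here refl)
... | true  | true  | refl = cong (x ∷_) (filterᵇ-cong xs (f≗g ∘ there))
... | false | false | refl = filterᵇ-cong xs (f≗g ∘ there)

length-filterᵇ-remove : ∀ {n} (f : Fin n → Bool) {q} xs → Unique xs → q ∈ xs → f q ≡ true →
  length (filterᵇ f xs) ≡ suc (length (filterᵇ (λ c → f c ∧ not (does (q ≟ᶠ c))) xs))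
length-filterᵇ-remove f {q} (q ∷ xs) (q∉xs ∷ _) (here refl) fq rewrite fq | dec-true (q ≟ᶠ q) refl =
  cong (suc ∘ length) (filterᵇ-cong xs λ {c} c∈xs →
    sym (trans (cong (λ b → f c ∧ not b) (dec-false (q ≟ᶠ c) (All.lookup q∉xs c∈xs))) (∧-identityʳ (f c))))
length-filterᵇ-remove f {q} (x ∷ xs) (x∉xs ∷ u) (there q∈xs) fq
  rewrite dec-false (q ≟ᶠ x) (λ q≡x → All.lookup x∉xs q∈xs (sym q≡x)) | ∧-identityʳ (f x) with f x
... | true  = cong suc (length-filterᵇ-remove f xs u q∈xs fq)
... | false = length-filterᵇ-remove f xs u q∈xs fq

Adj-sym : ∀ {n} (G : Graph n) {u v} → Adj G u v → Adj G v u
Adj-sym G {u} {v} a = trans (sym (Graph.sym G u v)) a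

module Burning {n} (G : Graph n) where

  walkLength : ∀ {u v} → Walk G u v → ℕ
  walkLength [] = 0
  walkLength (_ ∷ w) = suc (walkLength w)

  InBall : Fin n → ℕ → Fin n → Set
  InBall c r v = Σ (Walk G c v) λ w → walkLength w ≤ r

  inBall-centre : ∀ c r → InBall c r c
  inBall-centre c r = [] , z≤n

  inBall-step : ∀ {c d r v} → Adj G c d → InBall d r v → InBall c (suc r) v
  inBall-step a (w , l) = a ∷ w , s≤s l

  inBall-mono : ∀ {c r r' v} → r ≤ r' → InBall c r v → InBall c r' v
  inBall-mono r≤r' (w , l) = w , ≤-trans l r≤r'

  Burned-mono : ∀ {S v m m'} → m ≤ m' → Burned G S m v → Burned G S m' v
  Burned-mono {S} {v} {m} {m'} m≤m' b = subst (λ k → Burned G S k v) (m∸n+n≡m m≤m') (later (m' ∸ m))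
    where
    later : ∀ k → Burned G S (k + m) v
    later zero = b
    later (suc k) = inj₁ (later k)

  Burned-walk : ∀ {S m u v} (w : Walk G u v) → Burned G S m u → Burned G S (walkLength w + m) v
  Burned-walk [] b = b
  Burned-walk {S} {m} {v = v} (a ∷ w) b =
    subst (λ k → Burned G S k v) (+-suc (walkLength w) m) (Burned-walk w (inj₂ (inj₂ (_ , a , b))))

  nth-++ : ∀ (pre : List (Fin n)) c S → nth (pre ++ c ∷ S) (length pre) ≡ just c
  nth-++ [] c S = refl
  nth-++ (_ ∷ pre) c S = nth-++ pre c S

  -- v lies in the ball of radius k − i around the i-th entry x_i of S = (x₁, …, x_k),
  -- so burning S in order has burned v by round k.
  Covered : List (Fin n) → Fin n → Set
  Covered [] v = ⊥
  Covered (c ∷ S) v = InBall c (length S) v ⊎ Covered S v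

  Covered⇒Burned : ∀ pre S {v} → Covered S v → Burned G (pre ++ S) (length pre + length S) v
  Covered⇒Burned pre (c ∷ S) (inj₁ (w , l)) =
    Burned-mono radius (Burned-walk w (inj₂ (inj₁ (nth-++ pre c S))))
    where
    radius : walkLength w + suc (length pre) ≤ length pre + suc (length S)
    radius = begin
      walkLength w + suc (length pre) ≤⟨ +-monoˡ-≤ _ l ⟩
      length S + suc (length pre)     ≡⟨ +-comm (length S) _ ⟩
      suc (length pre) + length S     ≡⟨ +-suc (length pre) (length S) ⟨
      length pre + suc (length S)     ∎
      where open ≤-Reasoning
  Covered⇒Burned pre (c ∷ S) {v} (inj₂ cov) =
    subst₂ (λ L k → Burned G L k v) (++-assoc pre [ c ] S) rounds (Covered⇒Burned (pre ++ [ c ]) S cov)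
    where
    rounds : length (pre ++ [ c ]) + length S ≡ length pre + suc (length S)
    rounds = trans (cong (_+ length S) (length-++ pre)) (+-assoc (length pre) 1 (length S))

  covering⇒burningSequence : ∀ S → (∀ v → Covered S v) → IsBurningSequence G S
  covering⇒burningSequence S cov v = Covered⇒Burned [] S (cov v)

module RoseTrees {n} (G : Graph n) where
  open Burning G

  data Rose : Set where
    node : Fin n → List Rose → Rose

  root : Rose → Fin n
  root (node p _) = p

  mutual
    vertices : Rose → List (Fin n)
    vertices (node p ts) = p ∷ verticesᶠ ts

    verticesᶠ : List Rose → List (Fin n)
    verticesᶠ [] = []
    verticesᶠ (t ∷ ts) = vertices t ++ verticesᶠ ts

  mutual
    height : Rose → ℕ
    height (node p ts) = heightᶠ ts

    heightᶠ : List Rose → ℕ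
    heightᶠ [] = 0
    heightᶠ (t ∷ ts) = suc (height t) ⊔ heightᶠ ts

  mutual
    Embedded : Rose → Set
    Embedded (node p ts) = Embeddedᶠ p ts

    Embeddedᶠ : Fin n → List Rose → Set
    Embeddedᶠ p [] = ⊤
    Embeddedᶠ p (t ∷ ts) = (Adj G p (root t) × Embedded t) × Embeddedᶠ p ts

  -- e is 1 when the root of the tree has a parent, so that e + length ts is
  -- the degree of the root; weight 0 of the whole tree is then n + d.
  mutual
    weight : ℕ → Rose → ℕ
    weight e (node p ts) = vertexWeight (e + length ts) + weightᶠ ts

    weightᶠ : List Rose → ℕ
    weightᶠ [] = 0
    weightᶠ (t ∷ ts) = weight 1 t + weightᶠ ts

  weight-pos : ∀ e t → 1 ≤ weight e t
  weight-pos e (node p ts) = ≤-trans (vertexWeight-pos (e + length ts)) (m≤m+n _ _)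

  weightᶠ-pos : ∀ t ts → 1 ≤ weightᶠ (t ∷ ts)
  weightᶠ-pos t ts = ≤-trans (weight-pos 1 t) (m≤m+n _ _)

  weightᶠ≤weight : ∀ e p ts → weightᶠ ts ≤ weight e (node p ts)
  weightᶠ≤weight e p ts = m≤n+m (weightᶠ ts) _

  -- Each vertex on a longest downward path either has degree 2 and weight 2,
  -- or a further subtree of weight at least 1 hangs from it.
  mutual
    weight-height : ∀ t → suc (height t + height t) ≤ weight 1 t
    weight-height (node p []) = s≤s z≤n
    weight-height (node p (t ∷ [])) = s≤s (s≤s (begin
      height t + suc (height t) ≡⟨ +-suc (height t) (height t) ⟩
      suc (height t + height t) ≤⟨ weight-height t ⟩
      weight 1 t                ≤⟨ m≤m+n (weight 1 t) 0 ⟩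
      weight 1 t + 0            ∎))
      where open ≤-Reasoning
    weight-height (node p (t ∷ ts@(t' ∷ ts'))) = s≤s (double-⊔-lub (suc (height t)) (heightᶠ ts)
      (≤-trans (≤-reflexive (trans (cong suc (+-suc (height t) (height t))) (+-comm 1 _)))
               (+-mono-≤ (weight-height t) (weightᶠ-pos t' ts')))
      (≤-trans (weightᶠ-heightᶠ ts) (+-monoˡ-≤ _ (weight-pos 1 t))))

    weightᶠ-heightᶠ : ∀ ts → heightᶠ ts + heightᶠ ts ≤ suc (weightᶠ ts)
    weightᶠ-heightᶠ [] = z≤n
    weightᶠ-heightᶠ (t ∷ ts) = double-⊔-lub (suc (height t)) (heightᶠ ts)
      (s≤s (≤-trans (≤-reflexive (+-suc (height t) (height t))) (≤-trans (weight-height t) (m≤m+n _ _))))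
      (≤-trans (weightᶠ-heightᶠ ts) (s≤s (m≤n+m _ _)))

  -- ts is o with the subtree t inserted somewhere.
  record Extract (p : Fin n) (ts : List Rose) (t : Rose) (o : List Rose) : Set₁ where
    field
      length≡    : length ts ≡ suc (length o)
      weightᶠ≡   : weightᶠ ts ≡ weight 1 t + weightᶠ o
      ∈⁻         : ∀ {v} → v ∈ verticesᶠ ts → v ∈ vertices t ⊎ v ∈ verticesᶠ o
      ∈-picked   : ∀ {v} → v ∈ vertices t → v ∈ verticesᶠ ts
      ∈-rest     : ∀ {v} → v ∈ verticesᶠ o → v ∈ verticesᶠ ts
      embedded⁻  : Embeddedᶠ p ts → (Adj G p (root t) × Embedded t) × Embeddedᶠ p o
      embedded⁺  : Adj G p (root t) × Embedded t → Embeddedᶠ p o → Embeddedᶠ p ts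
      All⁻       : ∀ {Q : Rose → Set} → All Q ts → Q t × All Q o

  extract : ∀ p ls t rs → Extract p (ls ++ t ∷ rs) t (ls ++ rs)
  extract p [] t rs = record
    { length≡ = refl ; weightᶠ≡ = refl ; ∈⁻ = ∈-++⁻ (vertices t) ; ∈-picked = ∈-++⁺ˡ
    ; ∈-rest = ∈-++⁺ʳ (vertices t) ; embedded⁻ = λ e → e ; embedded⁺ = _,_
    ; All⁻ = λ { (q ∷ qs) → q , qs } }
  extract p (l ∷ ls) t rs = record
    { length≡ = cong suc length≡
    ; weightᶠ≡ = trans (cong (weight 1 l +_) weightᶠ≡) (x∙yz≈y∙xz (weight 1 l) (weight 1 t) _)
    ; ∈⁻ = ∈⁻′
    ; ∈-picked = λ v∈ → ∈-++⁺ʳ (vertices l) (∈-picked v∈)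
    ; ∈-rest = ∈-rest′
    ; embedded⁻ = λ { (el , e) → let (et , eo) = embedded⁻ e in et , (el , eo) }
    ; embedded⁺ = λ { et (el , eo) → el , embedded⁺ et eo }
    ; All⁻ = λ { (q ∷ qs) → let (qt , qo) = All⁻ qs in qt , (q ∷ qo) }
    }
    where
    open Extract (extract p ls t rs)
    ∈⁻′ : ∀ {v} → v ∈ vertices l ++ verticesᶠ (ls ++ t ∷ rs) →
          v ∈ vertices t ⊎ v ∈ vertices l ++ verticesᶠ (ls ++ rs)
    ∈⁻′ v∈ with ∈-++⁻ (vertices l) v∈
    ... | inj₁ v∈l = inj₂ (∈-++⁺ˡ v∈l)
    ... | inj₂ v∈ts with ∈⁻ v∈ts
    ...   | inj₁ v∈t = inj₁ v∈t
    ...   | inj₂ v∈o = inj₂ (∈-++⁺ʳ (vertices l) v∈o)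
    ∈-rest′ : ∀ {v} → v ∈ vertices l ++ verticesᶠ (ls ++ rs) → v ∈ vertices l ++ verticesᶠ (ls ++ t ∷ rs)
    ∈-rest′ v∈ with ∈-++⁻ (vertices l) v∈
    ... | inj₁ v∈l = ∈-++⁺ˡ v∈l
    ... | inj₂ v∈o = ∈-++⁺ʳ (vertices l) (∈-rest v∈o)

  heightᶠ-witness : ∀ ts m → heightᶠ ts ≡ suc m →
                    ∃ λ ls → ∃ λ t → ∃ λ rs → ts ≡ ls ++ t ∷ rs × height t ≡ m
  heightᶠ-witness (t ∷ ts) m eq with ≤-total (suc (height t)) (heightᶠ ts)
  ... | inj₁ ≤ᶠ with heightᶠ-witness ts m (trans (sym (m≤n⇒m⊔n≡n ≤ᶠ)) eq)
  ...   | ls , t' , rs , refl , h≡ = t ∷ ls , t' , rs , refl , h≡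
  heightᶠ-witness (t ∷ ts) m eq | inj₂ ≥ᶠ = [] , t , ts , refl , suc-injective (trans (sym (m≥n⇒m⊔n≡m ≥ᶠ)) eq)

  height<heightᶠ : ∀ ts → All (λ t → height t < heightᶠ ts) ts
  height<heightᶠ [] = []
  height<heightᶠ (t ∷ ts) =
    m≤m⊔n (suc (height t)) (heightᶠ ts) ∷ All.map (λ h< → ≤-trans h< (m≤n⊔m _ _)) (height<heightᶠ ts)

  mutual
    inBall-root : ∀ {t v} → Embedded t → v ∈ vertices t → InBall (root t) (height t) v
    inBall-root {node p ts} emb (here refl) = inBall-centre p _
    inBall-root {node p ts} emb (there v∈) = inBall-rootᶠ emb v∈

    inBall-rootᶠ : ∀ {p ts v} → Embeddedᶠ p ts → v ∈ verticesᶠ ts → InBall p (heightᶠ ts) v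
    inBall-rootᶠ {ts = t ∷ ts} ((a , emb) , embs) v∈ with ∈-++⁻ (vertices t) v∈
    ... | inj₁ v∈t = inBall-mono (m≤m⊔n _ (heightᶠ ts)) (inBall-step a (inBall-root emb v∈t))
    ... | inj₂ v∈ts = inBall-mono (m≤n⊔m (suc (height t)) _) (inBall-rootᶠ embs v∈ts)

  inBall-root≡ : ∀ {t r v} → Embedded t → height t ≡ r → v ∈ vertices t → InBall (root t) r v
  inBall-root≡ emb refl = inBall-root emb

  ∈-verticesᶠ⁻ : ∀ ts {v} → v ∈ verticesᶠ ts → ∃ λ t → t ∈ ts × v ∈ vertices t
  ∈-verticesᶠ⁻ (t ∷ ts) v∈ with ∈-++⁻ (vertices t) v∈
  ... | inj₁ v∈t = t , here refl , v∈t
  ... | inj₂ v∈ts with ∈-verticesᶠ⁻ ts v∈ts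
  ...   | t' , t'∈ts , v∈t' = t' , there t'∈ts , v∈t'

  ∈-verticesᶠ⁺ : ∀ {ts t v} → t ∈ ts → v ∈ vertices t → v ∈ verticesᶠ ts
  ∈-verticesᶠ⁺ {t ∷ ts} (here refl) v∈t = ∈-++⁺ˡ v∈t
  ∈-verticesᶠ⁺ {t ∷ ts} (there t'∈ts) v∈t' = ∈-++⁺ʳ (vertices t) (∈-verticesᶠ⁺ t'∈ts v∈t')

  weight-height≡ : ∀ t {r} → height t ≡ r → suc (r + r) ≤ weight 1 t
  weight-height≡ t refl = weight-height t

  -- tree is what remains of t once the vertices satisfying B are removed; it is lighter by K.
  record Remainder (e : ℕ) (t : Rose) (B : Fin n → Set) (K : ℕ) : Set where
    constructor remainder
    field
      tree     : Rose
      root≡    : root tree ≡ root t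
      embedded : Embedded tree
      gain     : weight e tree + K ≤ weight e t
      cover    : ∀ {v} → v ∈ vertices t → B v ⊎ v ∈ vertices tree

  data Step (e : ℕ) (t : Rose) (r : ℕ) : Set where
    oneBall  : ∀ c → Remainder e t (InBall c r) (suc (r + r)) → Step e t r
    twoBalls : ∀ c c' → Remainder e t (λ v → InBall c r v ⊎ InBall c' (pred r) v) ((r + r) + (r + r)) →
               Step e t r

  peel-deg≢3 : ∀ {e p ts w o r} → Extract p ts w o → Embedded (node p ts) → height w ≡ r →
               e + length ts ≢ 3 → Step e (node p ts) r
  peel-deg≢3 {e} {p} {ts} {w} {o} {r} ext emb hw ≢3 = oneBall (root w) (remainder (node p o) refl embO gain cover)
    where
    open Extract ext
    embO : Embeddedᶠ p o
    embO = proj₂ (embedded⁻ emb)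
    deg≡ : e + length ts ≡ suc (e + length o)
    deg≡ = trans (cong (e +_) length≡) (+-suc e (length o))
    drop : vertexWeight (e + length o) ≤ vertexWeight (e + length ts)
    drop = subst (λ d → vertexWeight (e + length o) ≤ vertexWeight d) (sym deg≡)
                 (vertexWeight-mono _ (λ ≡3 → ≢3 (trans deg≡ ≡3)))
    gain : weight e (node p o) + suc (r + r) ≤ weight e (node p ts)
    gain = begin
      vertexWeight (e + length o) + weightᶠ o + suc (r + r)
        ≤⟨ +-mono-≤ (+-monoˡ-≤ _ drop) (weight-height≡ w hw) ⟩
      vertexWeight (e + length ts) + weightᶠ o + weight 1 w
        ≡⟨ +-assoc (vertexWeight (e + length ts)) _ _ ⟩
      vertexWeight (e + length ts) + (weightᶠ o + weight 1 w)
        ≡⟨ cong (vertexWeight (e + length ts) +_) (trans (+-comm (weightᶠ o) _) (sym weightᶠ≡)) ⟩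
      vertexWeight (e + length ts) + weightᶠ ts ∎
      where open ≤-Reasoning
    cover : ∀ {v} → v ∈ vertices (node p ts) → InBall (root w) r v ⊎ v ∈ vertices (node p o)
    cover (here refl) = inj₂ (here refl)
    cover (there v∈) with ∈⁻ v∈
    ... | inj₁ v∈w = inj₁ (inBall-root≡ (proj₂ (proj₁ (embedded⁻ emb))) hw v∈w)
    ... | inj₂ v∈o = inj₂ (there v∈o)

  -- Removing a single child of a degree-3 vertex p would raise its weight to 2,
  -- so as far as possible both w and x are removed.
  module Degree3 {e p ts w y xs rest} (ext : Extract p ts w (node y xs ∷ rest))
                 (emb : Embedded (node p ts)) (deg≡3 : e + length ts ≡ 3) where
    open Extract ext

    x : Rose
    x = node y xs

    adjW : Adj G p (root w)
    adjW = proj₁ (proj₁ (embedded⁻ emb))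

    embW : Embedded w
    embW = proj₂ (proj₁ (embedded⁻ emb))

    adjX : Adj G p y
    adjX = proj₁ (proj₁ (proj₂ (embedded⁻ emb)))

    embX : Embedded x
    embX = proj₂ (proj₁ (proj₂ (embedded⁻ emb)))

    embRest : Embeddedᶠ p rest
    embRest = proj₂ (proj₂ (embedded⁻ emb))

    deg-rest : e + length rest ≡ 1
    deg-rest = suc-injective (suc-injective (begin
      suc (suc (e + length rest)) ≡⟨ cong suc (+-suc e (length rest)) ⟨
      suc (e + suc (length rest)) ≡⟨ +-suc e (suc (length rest)) ⟨
      e + suc (length (x ∷ rest)) ≡⟨ cong (e +_) length≡ ⟨
      e + length ts               ≡⟨ deg≡3 ⟩
      3                           ∎))
      where open ≡-Reasoning
    weight-before : weight e (node p ts) ≡ 1 + (weight 1 w + (weight 1 x + weightᶠ rest))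
    weight-before = cong₂ _+_ (cong vertexWeight deg≡3) weightᶠ≡

    remove-w-x : weight e (node p rest) + (weight 1 w + weight 1 x) ≡ weight e (node p ts)
    remove-w-x = begin
      vertexWeight (e + length rest) + weightᶠ rest + (weight 1 w + weight 1 x)
        ≡⟨ cong (λ d → vertexWeight d + weightᶠ rest + (weight 1 w + weight 1 x)) deg-rest ⟩
      1 + weightᶠ rest + (weight 1 w + weight 1 x)
        ≡⟨ shuffle (weightᶠ rest) (weight 1 w) (weight 1 x) ⟩
      1 + (weight 1 w + (weight 1 x + weightᶠ rest))
        ≡⟨ weight-before ⟨
      weight e (node p ts) ∎
      where
      open ≡-Reasoning
      shuffle : ∀ R W X → 1 + R + (W + X) ≡ 1 + (W + (X + R))
      shuffle = solve-∀

    remove-x : weight e (node p (w ∷ rest)) + weight 1 x ≡ suc (weight e (node p ts))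
    remove-x = begin
      vertexWeight (e + suc (length rest)) + (weight 1 w + weightᶠ rest) + weight 1 x
        ≡⟨ cong (λ d → vertexWeight d + (weight 1 w + weightᶠ rest) + weight 1 x)
                (trans (+-suc e (length rest)) (cong suc deg-rest)) ⟩
      2 + (weight 1 w + weightᶠ rest) + weight 1 x
        ≡⟨ shuffle (weightᶠ rest) (weight 1 w) (weight 1 x) ⟩
      suc (1 + (weight 1 w + (weight 1 x + weightᶠ rest)))
        ≡⟨ cong suc weight-before ⟨
      suc (weight e (node p ts)) ∎
      where
      open ≡-Reasoning
      shuffle : ∀ R W X → 2 + (W + R) + X ≡ suc (1 + (W + (X + R)))
      shuffle = solve-∀

    gain-w-x : ∀ {K} → K ≤ weight 1 w + weight 1 x → weight e (node p rest) + K ≤ weight e (node p ts)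
    gain-w-x K≤ = ≤-trans (+-monoʳ-≤ _ K≤) (≤-reflexive remove-w-x)

    gain-x : ∀ {K} → suc K ≤ weight 1 x → weight e (node p (w ∷ rest)) + K ≤ weight e (node p ts)
    gain-x {K} 1+K≤ = ≤-pred (begin
      suc (weight e (node p (w ∷ rest)) + K) ≡⟨ +-suc _ K ⟨
      weight e (node p (w ∷ rest)) + suc K  ≤⟨ +-monoʳ-≤ _ 1+K≤ ⟩
      weight e (node p (w ∷ rest)) + weight 1 x ≡⟨ remove-x ⟩
      suc (weight e (node p ts)) ∎)
      where open ≤-Reasoning

    ∈-three : ∀ {v} → v ∈ verticesᶠ ts → v ∈ vertices w ⊎ v ∈ vertices x ⊎ v ∈ verticesᶠ rest
    ∈-three v∈ with ∈⁻ v∈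
    ... | inj₁ v∈w = inj₁ v∈w
    ... | inj₂ v∈o = inj₂ (∈-++⁻ (vertices x) v∈o)

    far : ∀ {r} → height w ≡ r → 2 + height x ≤ r → Step e (node p ts) r
    far {r} hw 2+hx≤r =
      oneBall (root w) (remainder (node p rest) refl embRest
                                  (gain-w-x (≤-trans (weight-height≡ w hw) (m≤m+n _ _))) cover)
      where
      cover : ∀ {v} → v ∈ vertices (node p ts) → InBall (root w) r v ⊎ v ∈ vertices (node p rest)
      cover (here refl) = inj₂ (here refl)
      cover (there v∈) with ∈-three v∈
      ... | inj₁ v∈w = inj₁ (inBall-root≡ embW hw v∈w)
      ... | inj₂ (inj₁ v∈x) =
        inj₁ (inBall-mono 2+hx≤r (inBall-step (Adj-sym G adjW) (inBall-step adjX (inBall-root embX v∈x))))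
      ... | inj₂ (inj₂ v∈rest) = inj₂ (there v∈rest)

    near : ∀ {r} → height w ≡ r → suc (height x) ≡ r → Step e (node p ts) r
    near hw refl = twoBalls (root w) y (remainder (node p rest) refl embRest (gain-w-x core) cover)
      where
      h : ℕ
      h = height x
      core : (suc h + suc h) + (suc h + suc h) ≤ weight 1 w + weight 1 x
      core = begin
        (suc h + suc h) + (suc h + suc h) ≡⟨ shuffle h ⟩
        suc (suc h + suc h) + suc (h + h) ≤⟨ +-mono-≤ (weight-height≡ w hw) (weight-height x) ⟩
        weight 1 w + weight 1 x           ∎
        where
        open ≤-Reasoning
        shuffle : ∀ h → (suc h + suc h) + (suc h + suc h) ≡ suc (suc h + suc h) + suc (h + h)
        shuffle = solve-∀
      cover : ∀ {v} → v ∈ vertices (node p ts) →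
              (InBall (root w) (suc h) v ⊎ InBall y h v) ⊎ v ∈ vertices (node p rest)
      cover (here refl) = inj₂ (here refl)
      cover (there v∈) with ∈-three v∈
      ... | inj₁ v∈w = inj₁ (inj₁ (inBall-root≡ embW hw v∈w))
      ... | inj₂ (inj₁ v∈x) = inj₁ (inj₂ (inBall-root embX v∈x))
      ... | inj₂ (inj₂ v∈rest) = inj₂ (there v∈rest)

    -- When the branches of x other than its deepest child z are short, a ball of
    -- radius r − 1 around z reaches them through y.
    twin-shallow : ∀ {r' z o} → Extract y xs z o → height w ≡ suc r' → height x ≡ suc r' →
                   height z ≡ r' → suc (heightᶠ o) ≤ r' → Step e (node p ts) (suc r')
    twin-shallow {r'} {z} {o} extX hw hx hz shallow = twoBalls (root w) (root z) (remainder (node p rest) refl embRest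
      (gain-w-x (+-mono-≤ (≤-trans (n≤1+n _) (weight-height≡ w hw)) (≤-trans (n≤1+n _) (weight-height≡ x hx))))
      cover)
      where
      adjZ : Adj G y (root z)
      adjZ = proj₁ (proj₁ (Extract.embedded⁻ extX embX))
      embZ : Embedded z
      embZ = proj₂ (proj₁ (Extract.embedded⁻ extX embX))
      embO : Embeddedᶠ y o
      embO = proj₂ (Extract.embedded⁻ extX embX)
      cover : ∀ {v} → v ∈ vertices (node p ts) →
              (InBall (root w) (suc r') v ⊎ InBall (root z) r' v) ⊎ v ∈ vertices (node p rest)
      cover (here refl) = inj₂ (here refl)
      cover (there v∈) with ∈-three v∈
      ... | inj₁ v∈w = inj₁ (inj₁ (inBall-root≡ embW hw v∈w))
      ... | inj₂ (inj₁ (here refl)) =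
        inj₁ (inj₂ (inBall-mono (≤-trans (s≤s z≤n) shallow) (inBall-step (Adj-sym G adjZ) (inBall-centre y 0))))
      ... | inj₂ (inj₁ (there v∈xs)) with Extract.∈⁻ extX v∈xs
      ...   | inj₁ v∈z = inj₁ (inj₂ (inBall-root≡ embZ hz v∈z))
      ...   | inj₂ v∈o = inj₁ (inj₂ (inBall-mono shallow (inBall-step (Adj-sym G adjZ) (inBall-rootᶠ embO v∈o))))
      cover (there v∈) | inj₂ (inj₂ v∈rest) = inj₂ (there v∈rest)

    -- Removing x alone raises the weight of p from 1 to 2, which the
    -- 4r' + 1 ≥ 2r' + 4 weight of x pays for once r' ≥ 2.
    twin-deep : ∀ {r' z o} → Extract y xs z o → height x ≡ suc r' → height z ≡ r' → r' ≤ heightᶠ o →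
                2 ≤ r' → Step e (node p ts) (suc r')
    twin-deep {r'} {z} {o} extX hx hz deep 2≤r' =
      oneBall y (remainder (node p (w ∷ rest)) refl ((adjW , embW) , embRest) (gain-x core) cover)
      where
      3≤o : 3 ≤ weightᶠ o
      3≤o = ≤-pred (≤-trans (+-mono-≤ 2≤r' 2≤r') (≤-trans (+-mono-≤ deep deep) (weightᶠ-heightᶠ o)))
      core : suc (suc (suc r' + suc r')) ≤ weight 1 x
      core = begin
        suc (suc (suc r' + suc r'))  ≡⟨ shuffle r' ⟩
        suc (suc (r' + r')) + 2      ≤⟨ +-mono-≤ (s≤s (weight-height≡ z hz)) (≤-trans (n≤1+n 2) 3≤o) ⟩
        suc (weight 1 z + weightᶠ o) ≡⟨ cong suc (Extract.weightᶠ≡ extX) ⟨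
        suc (weightᶠ xs)             ≤⟨ +-monoˡ-≤ (weightᶠ xs) (vertexWeight-pos (1 + length xs)) ⟩
        weight 1 x                   ∎
        where
        open ≤-Reasoning
        shuffle : ∀ r' → suc (suc (suc r' + suc r')) ≡ suc (suc (r' + r')) + 2
        shuffle = solve-∀
      cover : ∀ {v} → v ∈ vertices (node p ts) → InBall y (suc r') v ⊎ v ∈ vertices (node p (w ∷ rest))
      cover (here refl) = inj₂ (here refl)
      cover (there v∈) with ∈-three v∈
      ... | inj₁ v∈w = inj₂ (there (∈-++⁺ˡ v∈w))
      ... | inj₂ (inj₁ v∈x) = inj₁ (inBall-root≡ embX hx v∈x)
      ... | inj₂ (inj₂ v∈rest) = inj₂ (there (∈-++⁺ʳ (vertices w) v∈rest))

    twin : ∀ {r} → height w ≡ r → height x ≡ r → weight e (node p ts) ≤ suc r * suc r → Step e (node p ts) r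
    twin {r} hw hx bound = split (4r+3≤[1+r]²⇒3≤r r (≤-trans lower bound)) hw hx
      where
      lower : suc (suc (r + r) + suc (r + r)) ≤ weight e (node p ts)
      lower = ≤-trans (s≤s (+-mono-≤ (weight-height≡ w hw) (≤-trans (weight-height≡ x hx) (m≤m+n _ _))))
                      (≤-reflexive (sym weight-before))
      split : ∀ {r} → 3 ≤ r → height w ≡ r → height x ≡ r → Step e (node p ts) r
      split {suc r'} (s≤s 2≤r') hw hx with heightᶠ-witness xs r' hx
      ... | ls , z , rs , refl , hz with suc (heightᶠ (ls ++ rs)) ≤? r'
      ...   | yes shallow = twin-shallow (extract y ls z rs) hw hx hz shallow
      ...   | no ≰ = twin-deep (extract y ls z rs) hx hz (≤-pred (≰⇒> ≰)) 2≤r'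

    peel-deg≡3 : ∀ {r} → height w ≡ r → height x ≤ r → weight e (node p ts) ≤ suc r * suc r →
                 Step e (node p ts) r
    peel-deg≡3 {r} hw hx≤r bound with suc (suc (height x)) ≤? r
    ... | yes 2+hx≤r = far hw 2+hx≤r
    ... | no 2+hx≰r with suc (height x) ≟ r
    ...   | yes 1+hx≡r = near hw 1+hx≡r
    ...   | no 1+hx≢r = twin hw hx≡r bound
      where
      hx≡r : height x ≡ r
      hx≡r = ≤-antisym hx≤r (≤-pred (≤∧≢⇒< (≤-pred (≰⇒> 2+hx≰r)) (λ eq → 1+hx≢r (sym eq))))

  peel : ∀ {e p ts w o r} → e ≤ 1 → Extract p ts w o → Embedded (node p ts) → height w ≡ r →
         All (λ t → height t ≤ r) ts → weight e (node p ts) ≤ suc r * suc r → Step e (node p ts) r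
  peel {e} {ts = ts} e≤1 ext emb hw low bound with e + length ts ≟ 3
  ... | no ≢3 = peel-deg≢3 ext emb hw ≢3
  ... | yes ≡3 = branch ext (proj₂ (Extract.All⁻ ext low)) ≡3
    where
    branch : ∀ {o} → Extract _ ts _ o → All (λ t → height t ≤ _) o → e + length ts ≡ 3 → Step e _ _
    branch {[]} ext _ ≡3 = ⊥-elim (3≰2 (≤-trans (≤-reflexive (sym e+1≡3)) (+-monoˡ-≤ 1 e≤1)))
      where
      e+1≡3 : e + 1 ≡ 3
      e+1≡3 = subst (λ k → e + k ≡ 3) (Extract.length≡ ext) ≡3
      3≰2 : ¬ 3 ≤ 2
      3≰2 (s≤s (s≤s ()))
    branch {node y xs ∷ rest} ext (hx ∷ _) ≡3 = Degree3.peel-deg≡3 ext emb ≡3 hw hx bound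

  remainder-child : ∀ {e p ls t rs B K} → Embedded (node p (ls ++ t ∷ rs)) → Remainder 1 t B K →
                    Remainder e (node p (ls ++ t ∷ rs)) B K
  remainder-child {e} {p} {ls} {t} {rs} {B} {K} emb (remainder t' root≡ emb' gain cover) =
    remainder (node p (ls ++ t' ∷ rs)) refl embedded′ gain′ cover′
    where
    old : Extract p (ls ++ t ∷ rs) t (ls ++ rs)
    old = extract p ls t rs
    new : Extract p (ls ++ t' ∷ rs) t' (ls ++ rs)
    new = extract p ls t' rs
    open Extract old using (embedded⁻; ∈⁻)
    open Extract new using (embedded⁺; ∈-picked; ∈-rest)
    embedded′ : Embedded (node p (ls ++ t' ∷ rs))
    embedded′ = embedded⁺ (subst (Adj G p) (sym root≡) (proj₁ (proj₁ (embedded⁻ emb))) , emb')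
                          (proj₂ (embedded⁻ emb))
    gain′ : weight e (node p (ls ++ t' ∷ rs)) + K ≤ weight e (node p (ls ++ t ∷ rs))
    gain′ = begin
      vertexWeight (e + length (ls ++ t' ∷ rs)) + weightᶠ (ls ++ t' ∷ rs) + K
        ≡⟨ cong₂ (λ d f → vertexWeight (e + d) + f + K)
                 (trans (Extract.length≡ new) (sym (Extract.length≡ old))) (Extract.weightᶠ≡ new) ⟩
      D + (weight 1 t' + weightᶠ (ls ++ rs)) + K
        ≡⟨ shuffle D (weight 1 t') (weightᶠ (ls ++ rs)) K ⟩
      D + (weight 1 t' + K + weightᶠ (ls ++ rs))
        ≤⟨ +-monoʳ-≤ D (+-monoˡ-≤ (weightᶠ (ls ++ rs)) gain) ⟩
      D + (weight 1 t + weightᶠ (ls ++ rs))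
        ≡⟨ cong (D +_) (Extract.weightᶠ≡ old) ⟨
      weight e (node p (ls ++ t ∷ rs)) ∎
      where
      open ≤-Reasoning
      D : ℕ
      D = vertexWeight (e + length (ls ++ t ∷ rs))
      shuffle : ∀ a b c k → a + (b + c) + k ≡ a + (b + k + c)
      shuffle = solve-∀
    cover′ : ∀ {v} → v ∈ vertices (node p (ls ++ t ∷ rs)) → B v ⊎ v ∈ vertices (node p (ls ++ t' ∷ rs))
    cover′ (here refl) = inj₂ (here refl)
    cover′ (there v∈) with ∈⁻ v∈
    ... | inj₂ v∈o = inj₂ (there (∈-rest v∈o))
    ... | inj₁ v∈t with cover v∈t
    ...   | inj₁ b = inj₁ b
    ...   | inj₂ v∈t' = inj₂ (there (∈-picked v∈t'))

  step-child : ∀ {e p ls t rs r} → Embedded (node p (ls ++ t ∷ rs)) → Step 1 t r →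
               Step e (node p (ls ++ t ∷ rs)) r
  step-child emb (oneBall c rem) = oneBall c (remainder-child emb rem)
  step-child emb (twoBalls c c' rem) = twoBalls c c' (remainder-child emb rem)

  -- Walk down a deepest branch to a vertex with a child of height exactly r.
  step : ∀ h {e t r} → height t ≡ h → r < h → e ≤ 1 → Embedded t → weight e t ≤ suc r * suc r → Step e t r
  step (suc h) {e} {node p ts} {r} ht r<h e≤1 emb bound with heightᶠ-witness ts h ht
  ... | ls , c , rs , refl , hc with h ≟ r
  ...   | yes refl = peel e≤1 (extract p ls c rs) emb hc low bound
    where
    low : All (λ t → height t ≤ h) (ls ++ c ∷ rs)
    low = All.map (λ {t} h< → ≤-pred (subst (suc (height t) ≤_) ht h<)) (height<heightᶠ (ls ++ c ∷ rs))
  ...   | no h≢r = step-child emb (step h hc (≤∧≢⇒< (≤-pred r<h) (λ eq → h≢r (sym eq))) ≤-refl embC boundC)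
    where
    ext : Extract p (ls ++ c ∷ rs) c (ls ++ rs)
    ext = extract p ls c rs
    embC : Embedded c
    embC = proj₂ (proj₁ (Extract.embedded⁻ ext emb))
    boundC : weight 1 c ≤ suc r * suc r
    boundC = begin
      weight 1 c                       ≤⟨ m≤m+n (weight 1 c) _ ⟩
      weight 1 c + weightᶠ (ls ++ rs)  ≡⟨ Extract.weightᶠ≡ ext ⟨
      weightᶠ (ls ++ c ∷ rs)           ≤⟨ weightᶠ≤weight e p (ls ++ c ∷ rs) ⟩
      weight e (node p (ls ++ c ∷ rs)) ≤⟨ bound ⟩
      suc r * suc r                    ∎
      where open ≤-Reasoning

  Cover : ℕ → Rose → Set
  Cover k t = Σ (List (Fin n)) λ S → length S ≡ k × (∀ {v} → v ∈ vertices t → Covered S v)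

  cover-shallow : ∀ {r t} → Embedded t → height t ≤ r → Cover (suc r) t
  cover-shallow {r} {t} emb h≤r = root t ∷ replicate r (root t) , cong suc (length-replicate r) ,
    λ v∈ → inj₁ (inBall-mono (subst (height t ≤_) (sym (length-replicate r)) h≤r) (inBall-root emb v∈))

  cover-oneBall : ∀ {k t c t'} → (∀ {v} → v ∈ vertices t → InBall c k v ⊎ v ∈ vertices t') →
                  Cover k t' → Cover (suc k) t
  cover-oneBall {c = c} split (S , refl , cov) = c ∷ S , refl , λ v∈ → map₂ cov (split v∈)

  cover-twoBalls : ∀ {k t c c' t'} →
                   (∀ {v} → v ∈ vertices t → (InBall c (suc k) v ⊎ InBall c' k v) ⊎ v ∈ vertices t') →
                   Cover k t' → Cover (suc (suc k)) t
  cover-twoBalls {c = c} {c'} split (S , refl , cov) =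
    c ∷ c' ∷ S , refl , λ v∈ → [ map₂ inj₁ , inj₂ ∘ inj₂ ∘ cov ]′ (split v∈)

  weight-nonleaf : ∀ t → 1 ≤ height t → 2 ≤ weight 0 t
  weight-nonleaf (node p (t ∷ ts)) _ = +-mono-≤ (vertexWeight-pos (length (t ∷ ts))) (weightᶠ-pos t ts)

  CoverBound : ℕ → Set
  CoverBound k = ∀ t → Embedded t → weight 0 t ≤ k * k → Cover k t

  cover-step : ∀ r → CoverBound (suc r) → CoverBound r → CoverBound (suc (suc r))
  cover-step r cover₁ cover₀ t emb bound with height t ≤? suc r
  ... | yes h≤1+r = cover-shallow emb h≤1+r
  ... | no h≰1+r with step (height t) refl (≰⇒> h≰1+r) z≤n emb bound
  ...   | oneBall c (remainder t' _ emb' gain split) =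
    cover-oneBall split 
      (cover₁ t' emb' (+-cancelʳ-≤ _ _ _ (≤-trans gain (≤-trans bound (≤-reflexive (square-suc r))))))
  ...   | twoBalls c c' (remainder t' _ emb' gain split) =
    cover-twoBalls split
      (cover₀ t' emb' (+-cancelʳ-≤ _ _ _ (≤-trans gain (≤-trans bound (≤-reflexive (square-suc² r))))))

  cover : ∀ k → CoverBound k
  cover 0 t emb bound with () ← ≤-trans (weight-pos 0 t) bound
  cover 1 t emb bound with height t ≤? 0
  ... | yes h≤0 = cover-shallow emb h≤0
  ... | no h≰0 with s≤s () ← ≤-trans (weight-nonleaf t (≰⇒> h≰0)) bound
  cover (suc (suc r)) = cover-step r (cover (suc r)) (cover r)

module NonBacktrackingWalks {n} (G : Graph n) where
  open DecMembership (_≟ᶠ_ {n}) using (_∈?_)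

  Chain : List (Fin n) → Set
  Chain = Linked (Adj G)

  NonBacktracking : List (Fin n) → Set
  NonBacktracking [] = ⊤
  NonBacktracking (_ ∷ []) = ⊤
  NonBacktracking (_ ∷ _ ∷ []) = ⊤
  NonBacktracking (x ∷ y ∷ z ∷ l) = x ≢ z × NonBacktracking (y ∷ z ∷ l)

  NonBacktracking-tail : ∀ {x l} → NonBacktracking (x ∷ l) → NonBacktracking l
  NonBacktracking-tail {l = []} _ = tt
  NonBacktracking-tail {l = _ ∷ []} _ = tt
  NonBacktracking-tail {l = _ ∷ _ ∷ _} (_ , nb) = nb

  chain⇒closesPath : ∀ (a : Fin n) l b m → Chain (a ∷ l ++ b ∷ m) → ClosesPath G b (a ∷ l)
  chain⇒closesPath a [] b m (a~b ∷ _) = a~b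
  chain⇒closesPath a (y ∷ l) b m (a~y ∷ ch) = a~y , chain⇒closesPath y l b m ch

  Unique-rotate : ∀ (x : Fin n) ys₁ ys₂ → Unique (ys₁ ++ x ∷ ys₂) → Unique (x ∷ ys₁)
  Unique-rotate x [] ys₂ u = [] ∷ []
  Unique-rotate x (y ∷ ys₁) ys₂ (y∉ ∷ u) with Unique-rotate x ys₁ ys₂ u
  ... | x∉ys₁ ∷ uys₁ =
    ((λ x≡y → All.head (All.++⁻ʳ ys₁ y∉) (sym x≡y)) ∷ x∉ys₁) ∷ (All.++⁻ˡ ys₁ y∉ ∷ uys₁)

  -- Gluing the reverse of y ∷ ys onto y ∷ acc does not backtrack at y exactly
  -- when the two walks leave y in different directions.
  HeadsDiffer : List (Fin n) → List (Fin n) → Set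
  HeadsDiffer (a ∷ _) (b ∷ _) = a ≢ b
  HeadsDiffer _ _ = ⊤

  reverse-glue : ∀ ys y acc → Chain (y ∷ ys) → NonBacktracking (y ∷ ys) → Chain (y ∷ acc) →
                 NonBacktracking (y ∷ acc) → HeadsDiffer ys acc →
                 Chain (ys ʳ++ y ∷ acc) × NonBacktracking (ys ʳ++ y ∷ acc)
  reverse-glue [] y acc _ _ chA nbA _ = chA , nbA
  reverse-glue (z ∷ zs) y acc (y~z ∷ chZ) nbY chA nbA z≢a =
    reverse-glue zs z (y ∷ acc) chZ (NonBacktracking-tail nbY) (Adj-sym G y~z ∷ chA)
                 (extend acc z≢a nbA) (turn zs nbY)
    where
    extend : ∀ acc → HeadsDiffer (z ∷ zs) acc → NonBacktracking (y ∷ acc) → NonBacktracking (z ∷ y ∷ acc)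
    extend [] _ _ = tt
    extend (_ ∷ _) z≢a nb = z≢a , nb
    turn : ∀ zs → NonBacktracking (y ∷ z ∷ zs) → HeadsDiffer zs (y ∷ acc)
    turn [] _ = tt
    turn (_ ∷ _) (y≢t , _) = λ t≡y → y≢t (sym t≡y)

  Unique-ʳ++⁻ : ∀ xs (acc : List (Fin n)) → Unique (xs ʳ++ acc) → Unique acc
  Unique-ʳ++⁻ [] acc u = u
  Unique-ʳ++⁻ (y ∷ ys) acc u with Unique-ʳ++⁻ ys (y ∷ acc) u
  ... | _ ∷ u′ = u′

  ∈-both⇒¬Unique : ∀ {r} xs acc → r ∈ xs → r ∈ acc → ¬ Unique (xs ʳ++ acc)
  ∈-both⇒¬Unique (y ∷ ys) acc (here refl) r∈acc u with Unique-ʳ++⁻ ys (y ∷ acc) u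
  ... | y∉acc ∷ _ = All.lookup y∉acc r∈acc refl
  ∈-both⇒¬Unique (y ∷ ys) acc (there r∈ys) r∈acc u = ∈-both⇒¬Unique ys (y ∷ acc) r∈ys (there r∈acc) u

  module Acyclicity (acyclic : Acyclic G) where

    nonBacktracking-noReturn : ∀ (x : Fin n) ys₁ ys₂ → Chain (x ∷ ys₁ ++ x ∷ ys₂) →
                               NonBacktracking (x ∷ ys₁ ++ x ∷ ys₂) → Unique (ys₁ ++ x ∷ ys₂) → ⊥
    nonBacktracking-noReturn x [] ys₂ (x~x ∷ _) _ _ with () ← trans (sym x~x) (Graph.irrefl G x)
    nonBacktracking-noReturn x (y ∷ []) ys₂ _ (x≢x , _) _ = x≢x refl
    nonBacktracking-noReturn x ys₁@(_ ∷ _ ∷ _) ys₂ ch _ u =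
      acyclic (x ∷ ys₁) (s≤s (s≤s (s≤s z≤n)) , Unique-rotate x ys₁ ys₂ u , chain⇒closesPath x ys₁ x ys₂ ch)

    nonBacktracking⇒Unique : ∀ xs → Chain xs → NonBacktracking xs → Unique xs
    nonBacktracking⇒Unique [] _ _ = []
    nonBacktracking⇒Unique (x ∷ ys) ch nb
      with nonBacktracking⇒Unique ys (Linked.tail ch) (NonBacktracking-tail nb) | x ∈? ys
    ... | u | no x∉ys = ¬Any⇒All¬ ys x∉ys ∷ u
    ... | u | yes x∈ys with ∈-∃++ x∈ys
    ...   | ys₁ , ys₂ , refl = ⊥-elim (nonBacktracking-noReturn x ys₁ ys₂ ch nb u)

    module RootedAt (r₀ : Fin n) where

      RootPath : List (Fin n) → Set
      RootPath l = Chain l × NonBacktracking l × last l ≡ just r₀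

      last⇒∈ : ∀ {r} (x : Fin n) l → last (x ∷ l) ≡ just r → r ∈ x ∷ l
      last⇒∈ x [] refl = here refl
      last⇒∈ x (y ∷ l) end = there (last⇒∈ y l end)

      -- Two different root paths from x would combine into a non-backtracking
      -- walk through r₀ twice.
      rootPath-unique : ∀ (x : Fin n) P Q → RootPath (x ∷ P) → RootPath (x ∷ Q) → P ≡ Q
      rootPath-unique x [] [] _ _ = refl
      rootPath-unique x [] (b ∷ Q) (_ , _ , refl) (ch , nb , endQ) with nonBacktracking⇒Unique (x ∷ b ∷ Q) ch nb
      ... | x∉ ∷ _ = ⊥-elim (All.lookup x∉ (last⇒∈ b Q endQ) refl)
      rootPath-unique x (a ∷ P) [] (ch , nb , endP) (_ , _ , refl) with nonBacktracking⇒Unique (x ∷ a ∷ P) ch nb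
      ... | x∉ ∷ _ = ⊥-elim (All.lookup x∉ (last⇒∈ a P endP) refl)
      rootPath-unique x (a ∷ P) (b ∷ Q) (x~a ∷ chP , nbP , endP) (x~b ∷ chQ , nbQ , endQ) with a ≟ᶠ b
      ... | yes refl = cong (a ∷_) (rootPath-unique a P Q (chP , NonBacktracking-tail nbP , endP)
                                                         (chQ , NonBacktracking-tail nbQ , endQ))
      ... | no a≢b = ⊥-elim (∈-both⇒¬Unique (a ∷ P) (x ∷ b ∷ Q) (last⇒∈ a P endP) (there (last⇒∈ b Q endQ))
                               (nonBacktracking⇒Unique _ (proj₁ glued) (proj₂ glued)))
        where
        leaves-differently : ∀ P → NonBacktracking (x ∷ a ∷ P) → HeadsDiffer P (x ∷ b ∷ Q)
        leaves-differently [] _ = tt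
        leaves-differently (_ ∷ _) (x≢c , _) = λ c≡x → x≢c (sym c≡x)
        glued : Chain (P ʳ++ a ∷ x ∷ b ∷ Q) × NonBacktracking (P ʳ++ a ∷ x ∷ b ∷ Q)
        glued = reverse-glue P a (x ∷ b ∷ Q) chP (NonBacktracking-tail nbP) (Adj-sym G x~a ∷ x~b ∷ chQ)
                             (a≢b , nbQ) (leaves-differently P nbP)

module Unfolding {n} (G : Graph n) (acyclic : Acyclic G) (r₀ : Fin n) where
  open RoseTrees G
  open NonBacktrackingWalks G
  open Acyclicity acyclic
  open RootedAt r₀

  -- anc lists the ancestors of p, nearest first; a child of p is a neighbour
  -- other than its parent.
  isChild : Fin n → List (Fin n) → Fin n → Bool
  isChild p [] c = adj G p c
  isChild p (q ∷ _) c = adj G p c ∧ not (does (q ≟ᶠ c))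

  children : Fin n → List (Fin n) → List (Fin n)
  children p anc = filterᵇ (isChild p anc) (allFin n)

  unfold : ℕ → Fin n → List (Fin n) → Rose
  unfold zero p anc = node p []
  unfold (suc f) p anc = node p (map (λ c → unfold f c (p ∷ anc)) (children p anc))

  Parent : List (Fin n) → Fin n → Set
  Parent [] v = ⊥
  Parent (q ∷ _) v = q ≡ v

  parentCount : List (Fin n) → ℕ
  parentCount [] = 0
  parentCount (_ ∷ _) = 1

  -- Root paths are repetition-free, so the fuel f = n − length anc never runs out.
  Invariant : ℕ → Fin n → List (Fin n) → Set
  Invariant f p anc = RootPath (p ∷ anc) × length anc + f ≡ n

  root-unfold : ∀ f c anc → root (unfold f c anc) ≡ c
  root-unfold zero c anc = refl
  root-unfold (suc f) c anc = refl

  root∈unfold : ∀ f c anc → c ∈ vertices (unfold f c anc)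
  root∈unfold zero c anc = here refl
  root∈unfold (suc f) c anc = here refl

  ∈-children⁻ : ∀ p anc {c} → c ∈ children p anc → T (isChild p anc c)
  ∈-children⁻ p anc c∈ = proj₂ (∈-filter⁻ (T? ∘ isChild p anc) {xs = allFin n} c∈)

  isChild⇒Adj : ∀ {p} anc {c} → T (isChild p anc c) → Adj G p c
  isChild⇒Adj [] child = Equivalence.to T-≡ child
  isChild⇒Adj (q ∷ _) child = Equivalence.to T-≡ (proj₁ (Equivalence.to T-∧ child))

  isChild⇒≢parent : ∀ {p} q anc {c} → T (isChild p (q ∷ anc) c) → q ≢ c
  isChild⇒≢parent {p} q anc {c} child q≡c =
    subst (λ b → T (not b)) (dec-true (q ≟ᶠ c) q≡c) (proj₂ (Equivalence.to T-∧ child))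

  Adj⇒isChild⊎Parent : ∀ {p} anc {v} → Adj G p v → T (isChild p anc v) ⊎ Parent anc v
  Adj⇒isChild⊎Parent [] p~v = inj₁ (Equivalence.from T-≡ p~v)
  Adj⇒isChild⊎Parent (q ∷ _) {v} p~v with q ≟ᶠ v
  ... | yes q≡v = inj₂ q≡v
  ... | no _ = inj₁ (Equivalence.from T-∧ (Equivalence.from T-≡ p~v , tt))

  child-invariant : ∀ {f p anc c} → Invariant (suc f) p anc → T (isChild p anc c) → Invariant f c (p ∷ anc)
  child-invariant {f} {p} {anc} {c} ((ch , nb , end) , len) child =
    (Adj-sym G (isChild⇒Adj anc child) ∷ ch , extend anc nb child , end) , trans (sym (+-suc (length anc) f)) len
    where
    extend : ∀ anc → NonBacktracking (p ∷ anc) → T (isChild p anc c) → NonBacktracking (c ∷ p ∷ anc)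
    extend [] _ _ = tt
    extend (q ∷ anc) nb child = (λ c≡q → isChild⇒≢parent q anc child (sym c≡q)) , nb

  fuel-exhausted : ∀ {p anc} → ¬ Invariant zero p anc
  fuel-exhausted {p} {anc} ((ch , nb , _) , len) =
    1+n≰n (subst (λ k → suc k ≤ n) (trans (sym (+-identityʳ _)) len)
                 (Unique⇒length≤ (nonBacktracking⇒Unique (p ∷ anc) ch nb)))

  ∈-unfold⁻ : ∀ {f p anc v} → v ∈ vertices (unfold (suc f) p anc) →
              v ≡ p ⊎ ∃ λ c → c ∈ children p anc × v ∈ vertices (unfold f c (p ∷ anc))
  ∈-unfold⁻ (here v≡p) = inj₁ v≡p
  ∈-unfold⁻ {f} {p} {anc} (there v∈) with ∈-verticesᶠ⁻ _ v∈
  ... | t , t∈ , v∈t with ∈-map⁻ (λ c → unfold f c (p ∷ anc)) t∈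
  ...   | c , c∈ , refl = inj₂ (c , c∈ , v∈t)

  ∈-unfold⁺ : ∀ {f p anc c v} → c ∈ children p anc → v ∈ vertices (unfold f c (p ∷ anc)) →
              v ∈ vertices (unfold (suc f) p anc)
  ∈-unfold⁺ {f} {p} {anc} c∈ v∈ = there (∈-verticesᶠ⁺ (∈-map⁺ (λ c → unfold f c (p ∷ anc)) c∈) v∈)

  embedded-unfold : ∀ f p anc → Embedded (unfold f p anc)
  embedded-unfold zero p anc = tt
  embedded-unfold (suc f) p anc = embeddedᶠ (children p anc) (all-filter (T? ∘ isChild p anc) (allFin n))
    where
    embeddedᶠ : ∀ cs → All (T ∘ isChild p anc) cs → Embeddedᶠ p (map (λ c → unfold f c (p ∷ anc)) cs)
    embeddedᶠ [] [] = tt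
    embeddedᶠ (c ∷ cs) (child ∷ cs-children) =
      (subst (Adj G p) (sym (root-unfold f c _)) (isChild⇒Adj anc child) , embedded-unfold f c (p ∷ anc)) ,
      embeddedᶠ cs cs-children

  ∈-unfold⇒rootPath : ∀ f {p anc v} → Invariant f p anc → v ∈ vertices (unfold f p anc) →
                      ∃ λ zs → ∃ λ tl → zs ++ p ∷ anc ≡ v ∷ tl × RootPath (v ∷ tl)
  ∈-unfold⇒rootPath zero inv (here refl) = [] , _ , refl , proj₁ inv
  ∈-unfold⇒rootPath (suc f) {p} {anc} inv v∈ with ∈-unfold⁻ v∈
  ... | inj₁ refl = [] , anc , refl , proj₁ inv
  ... | inj₂ (c , c∈ , v∈c) with ∈-unfold⇒rootPath f (child-invariant inv (∈-children⁻ p anc c∈)) v∈c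
  ...   | zs , tl , path≡ , rootPath = zs ++ [ c ] , tl , trans (++-assoc zs [ c ] (p ∷ anc)) path≡ , rootPath

  ∷ʳ-injectiveʳ : ∀ (zs zs' : List (Fin n)) {c c'} → zs ++ [ c ] ≡ zs' ++ [ c' ] → c ≡ c'
  ∷ʳ-injectiveʳ zs zs' {c} {c'} eq =
    ∷-injectiveˡ (trans (sym (reverse-++ zs [ c ])) (trans (cong reverse eq) (reverse-++ zs' [ c' ])))

  -- A vertex occurring twice in the unfolding would have two different root paths.
  root∉child : ∀ {f p anc c} → Invariant (suc f) p anc → T (isChild p anc c) →
               p ∉ vertices (unfold f c (p ∷ anc))
  root∉child {f} {p} {anc} {c} inv child p∈ with ∈-unfold⇒rootPath f (child-invariant inv child) p∈
  ... | zs , tl , path≡ , rootPath with rootPath-unique p tl anc rootPath (proj₁ inv)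
  ...   | refl with () ← ++-conicalʳ zs [ c ]
                          (++-identityˡ-unique (zs ++ [ c ]) (sym (trans (++-assoc zs [ c ] (p ∷ anc)) path≡)))

  children-disjoint : ∀ {f p anc c c' v} → Invariant (suc f) p anc → T (isChild p anc c) → T (isChild p anc c') →
                      v ∈ vertices (unfold f c (p ∷ anc)) → v ∈ vertices (unfold f c' (p ∷ anc)) → c ≡ c'
  children-disjoint {f} {p} {anc} {c} {c'} {v} inv child child' v∈c v∈c'
    with ∈-unfold⇒rootPath f (child-invariant inv child) v∈c
       | ∈-unfold⇒rootPath f (child-invariant inv child') v∈c'
  ... | zs , tl , path≡ , rootPath | zs' , tl' , path≡' , rootPath' with rootPath-unique v tl tl' rootPath rootPath'
  ...   | refl = ∷ʳ-injectiveʳ zs zs' (++-cancelʳ (p ∷ anc) (zs ++ [ c ]) (zs' ++ [ c' ]) (begin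
    (zs ++ [ c ]) ++ p ∷ anc    ≡⟨ ++-assoc zs [ c ] (p ∷ anc) ⟩
    zs ++ c ∷ p ∷ anc           ≡⟨ trans path≡ (sym path≡') ⟩
    zs' ++ c' ∷ p ∷ anc         ≡⟨ ++-assoc zs' [ c' ] (p ∷ anc) ⟨
    (zs' ++ [ c' ]) ++ p ∷ anc  ∎))
    where open ≡-Reasoning

  unique-unfold : ∀ f {p anc} → Invariant f p anc → Unique (vertices (unfold f p anc))
  unique-unfold zero _ = [] ∷ []
  unique-unfold (suc f) {p} {anc} inv =
    All.tabulate (λ v∈ p≡v → root-below (subst (_∈ _) (sym p≡v) v∈)) ∷
    uniqueᶠ (children p anc) (Unique.filter⁺ (T? ∘ isChild p anc) (Unique.allFin⁺ n))
            (all-filter (T? ∘ isChild p anc) (allFin n))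
    where
    root-below : p ∉ verticesᶠ (map (λ c → unfold f c (p ∷ anc)) (children p anc))
    root-below p∈ with ∈-verticesᶠ⁻ _ p∈
    ... | t , t∈ , p∈t with ∈-map⁻ (λ c → unfold f c (p ∷ anc)) t∈
    ...   | c , c∈ , refl = root∉child inv (∈-children⁻ p anc c∈) p∈t
    uniqueᶠ : ∀ cs → Unique cs → All (T ∘ isChild p anc) cs →
              Unique (verticesᶠ (map (λ c → unfold f c (p ∷ anc)) cs))
    uniqueᶠ [] _ _ = []
    uniqueᶠ (c ∷ cs) (c∉cs ∷ u) (child ∷ cs-children) =
      Unique.++⁺ (unique-unfold f (child-invariant inv child)) (uniqueᶠ cs u cs-children) disjoint
      where
      disjoint : ∀ {v} → ¬ (v ∈ vertices (unfold f c (p ∷ anc)) ×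
                            v ∈ verticesᶠ (map (λ c → unfold f c (p ∷ anc)) cs))
      disjoint (v∈c , v∈cs) with ∈-verticesᶠ⁻ _ v∈cs
      ... | t , t∈ , v∈t with ∈-map⁻ (λ c → unfold f c (p ∷ anc)) t∈
      ...   | c' , c'∈cs , refl =
        All.lookup c∉cs c'∈cs (children-disjoint inv child (All.lookup cs-children c'∈cs) v∈c v∈t)

  degree-unfold : ∀ {p anc} → Chain (p ∷ anc) → parentCount anc + length (children p anc) ≡ degree G p
  degree-unfold {anc = []} _ = refl
  degree-unfold {p} {q ∷ anc} (p~q ∷ _) =
    sym (length-filterᵇ-remove (adj G p) (allFin n) (Unique.allFin⁺ n) (∈-allFin q) p~q)

  weight-unfold : ∀ f {p anc} → Invariant f p anc →
                  weight (parentCount anc) (unfold f p anc) ≡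
                  sum (map (vertexWeight ∘ degree G) (vertices (unfold f p anc)))
  weight-unfold zero inv = ⊥-elim (fuel-exhausted inv)
  weight-unfold (suc f) {p} {anc} inv@((ch , _) , _) =
    cong₂ _+_ (cong vertexWeight (trans (cong (parentCount anc +_) (length-map _ (children p anc))) (degree-unfold ch)))
              (weightᶠ-unfold (children p anc) (all-filter (T? ∘ isChild p anc) (allFin n)))
    where
    weightᶠ-unfold : ∀ cs → All (T ∘ isChild p anc) cs →
                     weightᶠ (map (λ c → unfold f c (p ∷ anc)) cs) ≡
                     sum (map (vertexWeight ∘ degree G) (verticesᶠ (map (λ c → unfold f c (p ∷ anc)) cs)))
    weightᶠ-unfold [] [] = refl
    weightᶠ-unfold (c ∷ cs) (child ∷ cs-children) =
      trans (cong₂ _+_ (weight-unfold f (child-invariant inv child)) (weightᶠ-unfold cs cs-children))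
            (sym (sum-map-++ (vertexWeight ∘ degree G) (vertices (unfold f c (p ∷ anc))) _))

  unfold-closed : ∀ f {p anc u v} → Invariant f p anc → u ∈ vertices (unfold f p anc) → Adj G u v →
                  v ∈ vertices (unfold f p anc) ⊎ Parent anc v
  unfold-closed zero inv _ _ = ⊥-elim (fuel-exhausted inv)
  unfold-closed (suc f) {p} {anc} {v = v} inv u∈ u~v with ∈-unfold⁻ u∈
  ... | inj₁ refl with Adj⇒isChild⊎Parent anc u~v
  ...   | inj₁ child = inj₁ (∈-unfold⁺ (∈-filter⁺ (T? ∘ isChild p anc) (∈-allFin v) child) (root∈unfold f v _))
  ...   | inj₂ parent = inj₂ parent
  unfold-closed (suc f) {p} {anc} inv u∈ u~v | inj₂ (c , c∈ , u∈c)
    with unfold-closed f (child-invariant inv (∈-children⁻ p anc c∈)) u∈c u~v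
  ... | inj₁ v∈c = inj₁ (∈-unfold⁺ c∈ v∈c)
  ... | inj₂ refl = inj₁ (here refl)

  T₀ : Rose
  T₀ = unfold n r₀ []

  invariant₀ : Invariant n r₀ []
  invariant₀ = (Linked.[-] , tt , refl) , refl

  ∈-T₀ : Connected G → ∀ v → v ∈ vertices T₀
  ∈-T₀ connected v = along (connected r₀ v) (root∈unfold n r₀ [])
    where
    along : ∀ {u v} → Walk G u v → u ∈ vertices T₀ → v ∈ vertices T₀
    along [] u∈ = u∈
    along (u~w ∷ walk) u∈ with unfold-closed n invariant₀ u∈ u~w
    ... | inj₁ w∈ = along walk w∈

  weight-T₀ : weight 0 T₀ ≤ n + numDeg2 G
  weight-T₀ = begin
    weight 0 T₀                                         ≡⟨ weight-unfold n invariant₀ ⟩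
    sum (map (vertexWeight ∘ degree G) (vertices T₀))
      ≤⟨ sum-map-mono-⊆ _ _ (allFin n) (unique-unfold n invariant₀) (λ {v} _ → ∈-allFin v) ⟩
    sum (map (vertexWeight ∘ degree G) (allFin n))      ≡⟨ sum-vertexWeight (degree G) (allFin n) ⟩
    length (allFin n) + numDeg2 G                       ≡⟨ cong (_+ numDeg2 G) (length-tabulate id) ⟩
    n + numDeg2 G                                       ∎
    where open ≤-Reasoning

corollary3p1 : (n : ℕ) (T : Graph n) → IsTree T → (d : ℕ) → numDeg2 T ≡ d →
    Σ (List (Fin n)) (λ S → IsBurningSequence T S × length S ≤ ceilSqrt (n + d))
corollary3p1 zero T _ d _ = [] , (λ ()) , z≤n
corollary3p1 n@(suc _) T (connected , acyclic) _ refl =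
  burn (cover k T₀ (embedded-unfold n Fin.zero []) (≤-trans weight-T₀ (x≤ceilSqrt² (n + numDeg2 T))))
  where
  open Unfolding T acyclic Fin.zero
  open RoseTrees T using (Cover; cover)
  open Burning T using (covering⇒burningSequence)
  k : ℕ
  k = ceilSqrt (n + numDeg2 T)
  burn : Cover k T₀ → Σ (List (Fin n)) λ S → IsBurningSequence T S × length S ≤ k
  burn (S , length≡ , covered) =
    S , covering⇒burningSequence S (λ v → covered (∈-T₀ connected v)) , ≤-reflexive length≡
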